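{- Let $m,n,s>1$ be integers such that $\frac{s^m-1}{s-1}\equiv0\pmod n$ and $\gcd\left(n,\frac{s^j-1}{s-1}\right)=1$ for $1\le j<m$. Then the semidirect product $\mathcal C_n\rtimes_s\mathcal C_m=\langle a,b\mid b^n=a^m=1,\ aba^{ -1}=b^s\rangle$ is a flower group of order $mn$ with pistil $\{1\}$. Moreover, its petals consist of $n$ cyclic groups of order $m$ and one cyclic group of order $n$.
   Context: A cyclic subgroup of a group is a $\mu$-subgroup if it is not contained in any cyclic subgroup other than itself. A finite noncyclic group $G$, whose set of $\mu$-subgroups is $\{C_1,\ldots,C_k\}$, is a flower group if there is a subgroup $C_0$ with $C_i\cap C_j=C_0$ for all $1\le i<j\le k$; $C_0$ is the pistil and $C_1,\ldots,C_k$ the petals. -}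

module Defs where

open import Data.Nat using (ℕ; zero; suc; _+_; _*_; _∸_; _^_; _<_; _≤_; NonZero; _/_)
open import Data.Nat.DivMod using (_mod_)
open import Data.Fin using (Fin; toℕ)
open import Data.Product using (Σ; _×_; _,_; ∃; ∃-syntax)
open import Data.Integer using (ℤ; +_; -[1+_])
open import Relation.Binary.PropositionalEquality using (_≡_; _≢_)
open import Relation.Nullary using (¬_)
open import Function.Bundles using (_↔_)

-- The geometric quotient (s^m - 1)/(s - 1), for s > 1.
-- (For s ≤ 1 the value is an irrelevant default; the theorem assumes s > 1.)
geom : ℕ → ℕ → ℕ
geom zero m = zero
geom (suc zero) m = zero
geom (suc (suc k)) m = (suc (suc k) ^ m ∸ 1) / suc k

module GroupNotions {A : Set} (_∙_ : A → A → A) (ε : A) (_⁻¹ : A → A) where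

  pow : A → ℕ → A
  pow g zero = ε
  pow g (suc k) = g ∙ pow g k

  zpow : A → ℤ → A
  zpow g (+ k) = pow g k
  zpow g -[1+ k ] = (pow g (suc k)) ⁻¹

  Subset : Set₁
  Subset = A → Set

  ⟨_⟩ : A → Subset
  ⟨ g ⟩ x = ∃[ k ] (x ≡ zpow g k)

  _⊆_ : Subset → Subset → Set
  P ⊆ Q = ∀ x → P x → Q x

  _≐_ : Subset → Subset → Set
  P ≐ Q = (P ⊆ Q) × (Q ⊆ P)

  _∩_ : Subset → Subset → Subset
  (P ∩ Q) x = P x × Q x

  HasSize : Subset → ℕ → Set
  HasSize P k = Fin k ↔ Σ A P

  IsFinite : Set
  IsFinite = ∃[ k ] (Fin k ↔ A)

  IsCyclicGroup : Set
  IsCyclicGroup = ∃[ g ] (∀ x → ⟨ g ⟩ x)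

  IsCyclicSubgroup : Subset → Set
  IsCyclicSubgroup C = ∃[ g ] (C ≐ ⟨ g ⟩)

  IsμSubgroup : Subset → Set₁
  IsμSubgroup C = IsCyclicSubgroup C × (∀ D → IsCyclicSubgroup D → C ⊆ D → D ≐ C)

  IsFlowerWith : (k : ℕ) → (Fin k → Subset) → Subset → Set₁
  IsFlowerWith k petals pistil =
      IsFinite
    × ¬ IsCyclicGroup
    × (∀ i → IsμSubgroup (petals i))
    × (∀ C → IsμSubgroup C → ∃[ i ] (C ≐ petals i))
    × (∀ i j → i ≢ j → ¬ (petals i ≐ petals j))
    × (∀ i j → i ≢ j → (petals i ∩ petals j) ≐ pistil)

  IsFlowerGroup : Set₁
  IsFlowerGroup = Σ ℕ λ k → Σ (Fin k → Subset) λ petals → Σ Subset λ pistil →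
    IsFlowerWith k petals pistil

-- The semidirect product C_n ⋊_s C_m = ⟨ a, b | b^n = a^m = 1, a b a⁻¹ = b^s ⟩,
-- realised by normal forms b^i a^j  ↦  (i , j) ∈ Z_n × Z_m, with
-- (b^i a^j)(b^k a^l) = b^(i + k s^j) a^(j + l).
module Semidirect (n m s : ℕ) .{{_ : NonZero n}} .{{_ : NonZero m}} where

  G : Set
  G = Fin n × Fin m

  _∙_ : G → G → G
  (i , j) ∙ (k , l) = (toℕ i + toℕ k * s ^ toℕ j) mod n , (toℕ j + toℕ l) mod m

  ε : G
  ε = 0 mod n , 0 mod m

  -- (b^i a^j)⁻¹ = a^(-j) b^(-i) = b^(-i s^(m-j)) a^(m-j)
  _⁻¹ : G → G
  (i , j) ⁻¹ = (n ∸ toℕ ((toℕ i * s ^ (m ∸ toℕ j)) mod n)) mod n , (m ∸ toℕ j) mod m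

  open GroupNotions _∙_ ε _⁻¹ public

-- Write b = (1 , 0) and a = (0 , 1), so that (i , j) is b^i a^j, and let S j = 1 + s + ⋯ + s^(j-1).
-- Then (b^c a)^j = b^(c S j) a^j.  As S m ≡ 0 and S j is a unit modulo n for 0 < j < m, the n
-- subgroups ⟨b^c a⟩ (c < n) have order m and meet each other and ⟨b⟩ trivially, and b^i a^j with
-- j ≠ 0 lies in ⟨b^c a⟩ for c ≡ i (S j)⁻¹.  So the n + 1 nontrivial cyclic subgroups ⟨b⟩, ⟨b^c a⟩
-- cover G and pairwise meet in 1.  Any such cyclic partition consists of the μ-subgroups: a cyclic
-- subgroup lies in the part containing its generator, and a part contains no other part's generator.

module Submission where

open import Defs
open import Algebra.Structures using (IsGroup)
open import Data.Empty using (⊥-elim)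
open import Data.Fin as Fin using (Fin; toℕ; fromℕ; inject₁)
open import Data.Fin.Properties using (toℕ-injective; toℕ-fromℕ<; toℕ<n; toℕ-fromℕ; toℕ-inject₁; *↔×)
open import Data.Integer as ℤ using (-[1+_])
open import Data.Nat
open import Data.Nat.DivMod using (_%_; _/_; _mod_; m≡m%n+[m/n]*n; %-distribˡ-+; %-distribˡ-*; m%n%n≡m%n; n%n≡0; m%n≤n; m%n<n; m<n⇒m%n≡m; [m+kn]%n≡m%n; m*n%n≡0; m*n/n≡m)
open import Data.Nat.Divisibility using (_∣_; n∣m⇒m%n≡0)
open import Data.Nat.GCD using (gcd; gcd-GCD; module Bézout)
open import Data.Nat.Properties
open import Data.Nat.Tactic.RingSolver using (solve-∀)
open import Data.Product using (Σ; ∃-syntax; _×_; _,_; proj₁; proj₂)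
open import Data.Product.Algebra using (×-comm)
open import Data.Sum using (_⊎_; inj₁; inj₂)
open import Function.Base using (_∘_)
open import Function.Bundles using (_↔_; mk↔ₛ′)
open import Function.Properties.Inverse using (↔-trans)
open import Relation.Binary.Bundles using (Setoid)
import Relation.Binary.Reasoning.Setoid
open import Relation.Binary.PropositionalEquality using (_≡_; _≢_; refl; sym; trans; cong; cong₂; subst; isEquivalence; module ≡-Reasoning)
open import Relation.Nullary using (¬_; yes; no)

module Congruence (n : ℕ) .{{_ : NonZero n}} where

  infix 4 _≈_
  _≈_ : ℕ → ℕ → Set
  a ≈ b = a % n ≡ b % n

  ≈-setoid : Setoid _ _
  ≈-setoid = record
    { Carrier = ℕ ; _≈_ = _≈_
    ; isEquivalence = record { refl = refl ; sym = sym ; trans = trans } }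

  module ≈-Reasoning = Relation.Binary.Reasoning.Setoid ≈-setoid

  +-cong : ∀ {a a′ b b′} → a ≈ a′ → b ≈ b′ → a + b ≈ a′ + b′
  +-cong {a} {a′} {b} {b′} p q = begin
    (a + b) % n            ≡⟨ %-distribˡ-+ a b n ⟩
    (a % n + b % n) % n    ≡⟨ cong₂ (λ u v → (u + v) % n) p q ⟩
    (a′ % n + b′ % n) % n  ≡⟨ %-distribˡ-+ a′ b′ n ⟨
    (a′ + b′) % n          ∎
    where open ≡-Reasoning

  *-cong : ∀ {a a′ b b′} → a ≈ a′ → b ≈ b′ → a * b ≈ a′ * b′
  *-cong {a} {a′} {b} {b′} p q = begin
    (a * b) % n              ≡⟨ %-distribˡ-* a b n ⟩
    (a % n * (b % n)) % n    ≡⟨ cong₂ (λ u v → (u * v) % n) p q ⟩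
    (a′ % n * (b′ % n)) % n  ≡⟨ %-distribˡ-* a′ b′ n ⟨
    (a′ * b′) % n            ∎
    where open ≡-Reasoning

  0%n≡0 : 0 % n ≡ 0
  0%n≡0 = m<n⇒m%n≡m (>-nonZero⁻¹ n)

  n≈0 : n ≈ 0
  n≈0 = trans (n%n≡0 n) (sym 0%n≡0)

  m%n≈m : ∀ a → a % n ≈ a
  m%n≈m a = m%n%n≡m%n a n

  ≡%⇒≈ : ∀ {a b} → a ≡ b % n → a ≈ b
  ≡%⇒≈ {b = b} p = trans (cong (_% n) p) (m%n≈m b)

  n∸m%n+m≈0 : ∀ a → (n ∸ a % n) + a ≈ 0
  n∸m%n+m≈0 a = begin
      ((n ∸ a % n) + a) % n       ≡⟨ +-cong {n ∸ a % n} refl (sym (m%n≈m a)) ⟩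
      ((n ∸ a % n) + a % n) % n   ≡⟨ cong (_% n) (m∸n+n≡m (m%n≤n a n)) ⟩
      n % n                       ≡⟨ n≈0 ⟩
      0 % n                       ∎
    where open ≡-Reasoning

  +-inverseʳ-unique : ∀ a b x → a + x ≈ 0 → b + x ≈ 0 → a ≈ b
  +-inverseʳ-unique a b x a+x≈0 b+x≈0 = begin
      a            ≡⟨ +-identityʳ a ⟨
      a + 0        ≈⟨ +-cong {a} refl (sym x+y≈0) ⟩
      a + (x + y)  ≡⟨ +-assoc a x y ⟨
      (a + x) + y  ≈⟨ +-cong a+x≈0 refl ⟩
      0 + y        ≈⟨ +-cong (sym b+x≈0) refl ⟩
      (b + x) + y  ≡⟨ +-assoc b x y ⟩
      b + (x + y)  ≈⟨ +-cong {b} refl x+y≈0 ⟩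
      b + 0        ≡⟨ +-identityʳ b ⟩
      b            ∎
    where
    open ≈-Reasoning
    y = n ∸ x % n
    x+y≈0 : x + y ≈ 0
    x+y≈0 = trans (cong (_% n) (+-comm x y)) (n∸m%n+m≈0 x)

  periodic-% : ∀ m .{{_ : NonZero m}} (f : ℕ → ℕ) → (∀ a → f (a + m) ≈ f a) → ∀ a → f (a % m) ≈ f a
  periodic-% m f f-periodic a =
    sym (trans (cong (λ b → f b % n) (m≡m%n+[m/n]*n a m)) (periodic-+* (a / m) (a % m)))
    where
    periodic-+* : ∀ q r → f (r + q * m) ≈ f r
    periodic-+* zero r = cong (λ b → f b % n) (+-identityʳ r)
    periodic-+* (suc q) r = begin
      f (r + (m + q * m)) ≡⟨ cong f (rearrange r m (q * m)) ⟩
      f (r + q * m + m)   ≈⟨ f-periodic (r + q * m) ⟩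
      f (r + q * m)       ≈⟨ periodic-+* q r ⟩
      f r                 ∎
      where
      open ≈-Reasoning
      rearrange : ∀ r m k → r + (m + k) ≡ r + k + m
      rearrange = solve-∀

  gcd≡1⇒invertible : ∀ k → gcd n k ≡ 1 → ∃[ u ] u * k ≈ 1
  gcd≡1⇒invertible k gcd≡1 with subst (λ d → Bézout.Identity d n k) gcd≡1 (Bézout.identity (gcd-GCD n k))
  ... | Bézout.-+ x y 1+xn≡yk = y , trans (cong (_% n) (sym 1+xn≡yk)) ([m+kn]%n≡m%n 1 x n)
  ... | Bézout.+- x y 1+yk≡xn = (n ∸ 1) * y , +-inverseʳ-unique _ 1 (n ∸ 1) uk+[n∸1]≈0 1+[n∸1]≈0
    where
    -- −y is the inverse: (n − 1)(y k + 1) = (n − 1) x n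
    uk+[n∸1]≈0 : (n ∸ 1) * y * k + (n ∸ 1) ≈ 0
    uk+[n∸1]≈0 = begin
      ((n ∸ 1) * y * k + (n ∸ 1)) % n ≡⟨ cong (_% n) (distrib (n ∸ 1) y k) ⟩
      ((n ∸ 1) * (1 + y * k)) % n     ≡⟨ cong (λ z → ((n ∸ 1) * z) % n) 1+yk≡xn ⟩
      ((n ∸ 1) * (x * n)) % n         ≡⟨ cong (_% n) (*-assoc (n ∸ 1) x n) ⟨
      ((n ∸ 1) * x * n) % n           ≡⟨ trans (m*n%n≡0 ((n ∸ 1) * x) n) (sym 0%n≡0) ⟩
      0 % n                           ∎
      where
      open ≡-Reasoning
      distrib : ∀ a y k → a * y * k + a ≡ a * (1 + y * k)
      distrib = solve-∀
    1+[n∸1]≈0 : 1 + (n ∸ 1) ≈ 0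
    1+[n∸1]≈0 = trans (cong (_% n) (m+[n∸m]≡n (>-nonZero⁻¹ n))) n≈0

repunit : ℕ → ℕ → ℕ
repunit s zero = 0
repunit s (suc k) = 1 + s * repunit s k

repunit-+ : ∀ s a b → repunit s (a + b) ≡ repunit s a + s ^ a * repunit s b
repunit-+ s zero b = sym (+-identityʳ (repunit s b))
repunit-+ s (suc a) b rewrite repunit-+ s a b = distrib (repunit s a) (s ^ a) (repunit s b) s
  where
  distrib : ∀ x y z s → 1 + s * (x + y * z) ≡ 1 + s * x + s * y * z
  distrib = solve-∀

repunit-*-pred : ∀ t k → repunit (suc t) k * t + 1 ≡ suc t ^ k
repunit-*-pred t zero = refl
repunit-*-pred t (suc k) = trans (distrib t (repunit (suc t) k)) (cong (suc t *_) (repunit-*-pred t k))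
  where
  distrib : ∀ t x → (1 + suc t * x) * t + 1 ≡ suc t * (x * t + 1)
  distrib = solve-∀

geom≡repunit : ∀ s → 1 < s → ∀ k → geom s k ≡ repunit s k
geom≡repunit (suc (suc t)) (s≤s (s≤s _)) k = begin
  (suc (suc t) ^ k ∸ 1) / suc t                      ≡⟨ cong (λ z → (z ∸ 1) / suc t) (repunit-*-pred (suc t) k) ⟨
  (repunit (suc (suc t)) k * suc t + 1 ∸ 1) / suc t  ≡⟨ cong (_/ suc t) (m+n∸n≡m (repunit (suc (suc t)) k * suc t) 1) ⟩
  (repunit (suc (suc t)) k * suc t) / suc t          ≡⟨ m*n/n≡m (repunit (suc (suc t)) k) (suc t) ⟩
  repunit (suc (suc t)) k                            ∎
  where open ≡-Reasoning

repunit≈0⇒^≈1 : ∀ n .{{_ : NonZero n}} t k → repunit (suc t) k % n ≡ 0 → suc t ^ k % n ≡ 1 % n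
repunit≈0⇒^≈1 n t k repunit≈0 = begin
  suc t ^ k % n                        ≡⟨ cong (_% n) (repunit-*-pred t k) ⟨
  (repunit (suc t) k * t + 1) % n      ≡⟨ +-cong (*-cong {repunit (suc t) k} {0} (trans repunit≈0 (sym 0%n≡0)) refl) refl ⟩
  1 % n                                ∎
  where
  open ≡-Reasoning
  open Congruence n

toℕ-mod : ∀ a k .{{_ : NonZero k}} → toℕ (a mod k) ≡ a % k
toℕ-mod a k = toℕ-fromℕ< _

mod-cong : ∀ {k} .{{_ : NonZero k}} {a b} → a % k ≡ b % k → a mod k ≡ b mod k
mod-cong {k} {a} {b} p = toℕ-injective (trans (toℕ-mod a k) (trans p (sym (toℕ-mod b k))))

≡-mod : ∀ {k} .{{_ : NonZero k}} (i : Fin k) a → toℕ i % k ≡ a % k → i ≡ a mod k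
≡-mod {k} i a p = toℕ-injective (trans (sym (m<n⇒m%n≡m (toℕ<n i))) (trans p (sym (toℕ-mod a k))))

module _ {A : Set} (_∙_ : A → A → A) (ε : A) (_⁻¹ : A → A) where
  open GroupNotions _∙_ ε _⁻¹

  record IsCyclicPartition (K : ℕ) (Q : Fin K → Subset) : Set where
    field
      generator : ∀ k → ∃[ g ] (Q k ⊆ ⟨ g ⟩ × Q k g × g ≢ ε)
      ⟨⟩-⊆ : ∀ k x → Q k x → ⟨ x ⟩ ⊆ Q k
      cover : ∀ x → ∃[ k ] Q k x
      trivial-∩ : ∀ k k′ → k ≢ k′ → ∀ x → Q k x → Q k′ x → x ≡ ε

  cyclicPartition⇒flower : ∀ {K Q} → IsFinite → (k₀ k₁ : Fin K) → k₀ ≢ k₁ →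
                           IsCyclicPartition K Q → IsFlowerWith K Q (_≡ ε)
  cyclicPartition⇒flower {K} {Q} finite k₀ k₁ k₀≢k₁ partition =
    finite , noncyclic , petal-μ , μ⇒petal , distinct , intersection
    where
    open IsCyclicPartition partition

    g : Fin K → A
    g k = proj₁ (generator k)

    g∈Q : ∀ k → Q k (g k)
    g∈Q k = proj₁ (proj₂ (proj₂ (generator k)))

    cyclic : ∀ k → IsCyclicSubgroup (Q k)
    cyclic k = g k , proj₁ (proj₂ (generator k)) , ⟨⟩-⊆ k (g k) (g∈Q k)

    unique-petal : ∀ k k′ → Q k′ (g k) → k ≡ k′
    unique-petal k k′ g∈Q′ with k Fin.≟ k′
    ... | yes k≡k′ = k≡k′
    ... | no k≢k′ = ⊥-elim (proj₂ (proj₂ (proj₂ (generator k))) (trivial-∩ k k′ k≢k′ (g k) (g∈Q k) g∈Q′))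

    petal-μ : ∀ k → IsμSubgroup (Q k)
    petal-μ k = cyclic k , λ D (h , D⊆⟨h⟩ , _) Q⊆D →
      let (k′ , h∈Q′) = cover h
          ⟨h⟩⊆Q′ = ⟨⟩-⊆ k′ h h∈Q′
          k≡k′ = unique-petal k k′ (⟨h⟩⊆Q′ (g k) (D⊆⟨h⟩ (g k) (Q⊆D (g k) (g∈Q k))))
      in (λ x x∈D → subst (λ k → Q k x) (sym k≡k′) (⟨h⟩⊆Q′ x (D⊆⟨h⟩ x x∈D))) , Q⊆D

    μ⇒petal : ∀ C → IsμSubgroup C → ∃[ k ] (C ≐ Q k)
    μ⇒petal C ((h , C⊆⟨h⟩ , _) , maximal) =
      let (k , h∈Q) = cover h
          (Q⊆C , C⊆Q) = maximal (Q k) (cyclic k) (λ x x∈C → ⟨⟩-⊆ k h h∈Q x (C⊆⟨h⟩ x x∈C))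
      in k , C⊆Q , Q⊆C

    distinct : ∀ k k′ → k ≢ k′ → ¬ (Q k ≐ Q k′)
    distinct k k′ k≢k′ (Q⊆Q′ , _) = k≢k′ (unique-petal k k′ (Q⊆Q′ (g k) (g∈Q k)))

    ε∈Q : ∀ k → Q k ε
    ε∈Q k = ⟨⟩-⊆ k (g k) (g∈Q k) ε (ℤ.+ 0 , refl)

    intersection : ∀ k k′ → k ≢ k′ → (Q k ∩ Q k′) ≐ (_≡ ε)
    intersection k k′ k≢k′ =
        (λ x (x∈Q , x∈Q′) → trivial-∩ k k′ k≢k′ x x∈Q x∈Q′)
      , λ { x refl → ε∈Q k , ε∈Q k′ }

    noncyclic : ¬ IsCyclicGroup
    noncyclic (h , generates) =
      let (k , h∈Q) = cover h
          in-petal-of-h : ∀ k′ → k′ ≡ k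
          in-petal-of-h k′ = unique-petal k′ k (⟨⟩-⊆ k h h∈Q (g k′) (generates (g k′)))
      in k₀≢k₁ (trans (in-petal-of-h k₀) (sym (in-petal-of-h k₁)))

module SemidirectGroup (n m s : ℕ) .{{_ : NonZero n}} .{{_ : NonZero m}} (s^m≈1 : s ^ m % n ≡ 1 % n) where
  open Semidirect n m s
  open Congruence n
  private module M = Congruence m

  s^-% : ∀ a → s ^ (a % m) ≈ s ^ a
  s^-% = periodic-% m (s ^_) λ a → begin
    s ^ (a + m)    ≡⟨ ^-distribˡ-+-* s a m ⟩
    s ^ a * s ^ m  ≈⟨ *-cong {s ^ a} refl s^m≈1 ⟩
    s ^ a * 1      ≡⟨ *-identityʳ _ ⟩
    s ^ a          ∎
    where open ≈-Reasoning

  toℕ-ε₁ : toℕ (proj₁ ε) ≡ 0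
  toℕ-ε₁ = trans (toℕ-mod 0 n) 0%n≡0

  toℕ-ε₂ : toℕ (proj₂ ε) ≡ 0
  toℕ-ε₂ = trans (toℕ-mod 0 m) M.0%n≡0

  m∸j+j≡m : ∀ (j : Fin m) → (m ∸ toℕ j) + toℕ j ≡ m
  m∸j+j≡m j = m∸n+n≡m (<⇒≤ (toℕ<n j))

  ∙-assoc : ∀ x y z → (x ∙ y) ∙ z ≡ x ∙ (y ∙ z)
  ∙-assoc (i , j) (k , l) (p , q) = cong₂ _,_ (mod-cong first) (mod-cong second)
    where
    I = toℕ i ; J = toℕ j ; K = toℕ k ; L = toℕ l ; P = toℕ p ; Q = toℕ q
    first : toℕ ((I + K * s ^ J) mod n) + P * s ^ toℕ ((J + L) mod m)
          ≈ I + toℕ ((K + P * s ^ L) mod n) * s ^ J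
    first = begin
      toℕ ((I + K * s ^ J) mod n) + P * s ^ toℕ ((J + L) mod m)
        ≡⟨ cong₂ (λ u v → u + P * s ^ v) (toℕ-mod _ n) (toℕ-mod _ m) ⟩
      (I + K * s ^ J) % n + P * s ^ ((J + L) % m)
        ≈⟨ +-cong (m%n≈m (I + K * s ^ J)) (*-cong {P} refl (s^-% (J + L))) ⟩
      I + K * s ^ J + P * s ^ (J + L)
        ≡⟨ cong (λ v → I + K * s ^ J + P * v) (^-distribˡ-+-* s J L) ⟩
      I + K * s ^ J + P * (s ^ J * s ^ L)
        ≡⟨ distrib I K P (s ^ J) (s ^ L) ⟩
      I + (K + P * s ^ L) * s ^ J
        ≈⟨ +-cong {I} refl (*-cong (sym (m%n≈m (K + P * s ^ L))) refl) ⟩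
      I + (K + P * s ^ L) % n * s ^ J
        ≡⟨ cong (λ u → I + u * s ^ J) (toℕ-mod _ n) ⟨
      I + toℕ ((K + P * s ^ L) mod n) * s ^ J ∎
      where
      open ≈-Reasoning
      distrib : ∀ i k p a b → i + k * a + p * (a * b) ≡ i + (k + p * b) * a
      distrib = solve-∀
    second : toℕ ((J + L) mod m) + Q M.≈ J + toℕ ((L + Q) mod m)
    second = begin
      toℕ ((J + L) mod m) + Q ≡⟨ cong (_+ Q) (toℕ-mod _ m) ⟩
      (J + L) % m + Q         ≈⟨ M.+-cong (M.m%n≈m (J + L)) refl ⟩
      J + L + Q               ≡⟨ +-assoc J L Q ⟩
      J + (L + Q)             ≈⟨ M.+-cong {J} refl (sym (M.m%n≈m (L + Q))) ⟩
      J + (L + Q) % m         ≡⟨ cong (J +_) (toℕ-mod _ m) ⟨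
      J + toℕ ((L + Q) mod m) ∎
      where open M.≈-Reasoning

  ∙-identityˡ : ∀ x → ε ∙ x ≡ x
  ∙-identityˡ (k , l) = sym (cong₂ _,_
    (≡-mod k _ (cong (_% n) (sym (trans (cong₂ (λ u v → u + toℕ k * s ^ v) toℕ-ε₁ toℕ-ε₂) (*-identityʳ (toℕ k))))))
    (≡-mod l _ (cong (_% m) (sym (cong (_+ toℕ l) toℕ-ε₂)))))

  ∙-identityʳ : ∀ x → x ∙ ε ≡ x
  ∙-identityʳ (i , j) = sym (cong₂ _,_
    (≡-mod i _ (cong (_% n) (sym (trans (cong (λ u → toℕ i + u * s ^ toℕ j) toℕ-ε₁) (+-identityʳ (toℕ i))))))
    (≡-mod j _ (cong (_% m) (sym (trans (cong (toℕ j +_) toℕ-ε₂) (+-identityʳ (toℕ j)))))))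

  ⁻¹-inverseˡ : ∀ x → (x ⁻¹) ∙ x ≡ ε
  ⁻¹-inverseˡ (i , j) = cong₂ _,_ (mod-cong first) (mod-cong second)
    where
    I = toℕ i ; J = toℕ j
    X = I * s ^ (m ∸ J)
    first : toℕ ((n ∸ toℕ (X mod n)) mod n) + I * s ^ toℕ ((m ∸ J) mod m) ≈ 0
    first = begin
      toℕ ((n ∸ toℕ (X mod n)) mod n) + I * s ^ toℕ ((m ∸ J) mod m)
        ≡⟨ cong₂ (λ u v → u + I * s ^ v) (trans (toℕ-mod _ n) (cong (λ w → (n ∸ w) % n) (toℕ-mod X n))) (toℕ-mod _ m) ⟩
      (n ∸ X % n) % n + I * s ^ ((m ∸ J) % m)
        ≈⟨ +-cong (m%n≈m (n ∸ X % n)) (*-cong {I} refl (s^-% (m ∸ J))) ⟩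
      (n ∸ X % n) + X
        ≈⟨ n∸m%n+m≈0 X ⟩
      0 ∎
      where open ≈-Reasoning
    second : toℕ ((m ∸ J) mod m) + J M.≈ 0
    second = begin
      toℕ ((m ∸ J) mod m) + J ≡⟨ cong (_+ J) (toℕ-mod _ m) ⟩
      (m ∸ J) % m + J         ≈⟨ M.+-cong (M.m%n≈m (m ∸ J)) refl ⟩
      m ∸ J + J               ≡⟨ m∸j+j≡m j ⟩
      m                       ≈⟨ M.n≈0 ⟩
      0                       ∎
      where open M.≈-Reasoning

  ⁻¹-inverseʳ : ∀ x → x ∙ (x ⁻¹) ≡ ε
  ⁻¹-inverseʳ (i , j) = cong₂ _,_ (mod-cong first) (mod-cong second)
    where
    I = toℕ i ; J = toℕ j
    X = I * s ^ (m ∸ J)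
    Y = n ∸ X % n
    Xs^J≈I : X * s ^ J ≈ I
    Xs^J≈I = begin
      X * s ^ J                  ≡⟨ *-assoc I _ _ ⟩
      I * (s ^ (m ∸ J) * s ^ J)  ≡⟨ cong (I *_) (^-distribˡ-+-* s (m ∸ J) J) ⟨
      I * s ^ ((m ∸ J) + J)      ≡⟨ cong (λ u → I * s ^ u) (m∸j+j≡m j) ⟩
      I * s ^ m                  ≈⟨ *-cong {I} refl s^m≈1 ⟩
      I * 1                      ≡⟨ *-identityʳ I ⟩
      I                          ∎
      where open ≈-Reasoning
    first : I + toℕ ((n ∸ toℕ (X mod n)) mod n) * s ^ J ≈ 0
    first = begin
      I + toℕ ((n ∸ toℕ (X mod n)) mod n) * s ^ J
        ≡⟨ cong (λ u → I + u * s ^ J) (trans (toℕ-mod _ n) (cong (λ w → (n ∸ w) % n) (toℕ-mod X n))) ⟩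
      I + Y % n * s ^ J       ≈⟨ +-cong {I} refl (*-cong (m%n≈m Y) refl) ⟩
      I + Y * s ^ J           ≈⟨ +-cong (sym Xs^J≈I) refl ⟩
      X * s ^ J + Y * s ^ J   ≡⟨ *-distribʳ-+ (s ^ J) X Y ⟨
      (X + Y) * s ^ J         ≈⟨ *-cong (trans (cong (_% n) (+-comm X Y)) (n∸m%n+m≈0 X)) refl ⟩
      0 * s ^ J               ≡⟨⟩
      0                       ∎
      where open ≈-Reasoning
    second : J + toℕ ((m ∸ J) mod m) M.≈ 0
    second = begin
      J + toℕ ((m ∸ J) mod m) ≡⟨ cong (J +_) (toℕ-mod _ m) ⟩
      J + (m ∸ J) % m         ≈⟨ M.+-cong {J} refl (M.m%n≈m (m ∸ J)) ⟩
      J + (m ∸ J)             ≡⟨ trans (+-comm J _) (m∸j+j≡m j) ⟩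
      m                       ≈⟨ M.n≈0 ⟩
      0                       ∎
      where open M.≈-Reasoning

  isGroup : IsGroup _≡_ _∙_ ε _⁻¹
  isGroup = record
    { isMonoid = record
      { isSemigroup = record
        { isMagma = record { isEquivalence = isEquivalence ; ∙-cong = cong₂ _∙_ }
        ; assoc = ∙-assoc }
      ; identity = ∙-identityˡ , ∙-identityʳ }
    ; inverse = ⁻¹-inverseˡ , ⁻¹-inverseʳ
    ; ⁻¹-cong = cong _⁻¹ }

module SemidirectPetals (n m s : ℕ) .{{_ : NonZero n}} .{{_ : NonZero m}}
  (1<n : 1 < n) (1<m : 1 < m) (s^m≈1 : s ^ m % n ≡ 1 % n) (n∣repunit : repunit s m % n ≡ 0)
  (invertible : ∀ j → 0 < j → j < m → ∃[ u ] (u * repunit s j) % n ≡ 1 % n) where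
  open Semidirect n m s
  open SemidirectGroup n m s s^m≈1
  open Congruence n
  private module M = Congruence m

  private
    S : ℕ → ℕ
    S = repunit s

  repunit-% : ∀ a → S (a % m) ≈ S a
  repunit-% = periodic-% m S λ a → begin
    S (a + m)          ≡⟨ repunit-+ s a m ⟩
    S a + s ^ a * S m  ≈⟨ +-cong {S a} refl (*-cong {s ^ a} refl (trans n∣repunit (sym 0%n≡0))) ⟩
    S a + s ^ a * 0    ≡⟨ cong (S a +_) (*-zeroʳ (s ^ a)) ⟩
    S a + 0            ≡⟨ +-identityʳ _ ⟩
    S a                ∎
    where open ≈-Reasoning

  -- petal c is ⟨b^c a⟩ for c < n, and petal n is ⟨b⟩.
  petal : ℕ → Subset
  petal c x = (c ≡ n × toℕ (proj₂ x) ≡ 0) ⊎ (c < n × toℕ (proj₁ x) ≡ (c * S (toℕ (proj₂ x))) % n)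

  ε∈petal : ∀ c → c ≤ n → petal c ε
  ε∈petal c c≤n with c ≟ n
  ... | yes c≡n = inj₁ (c≡n , toℕ-ε₂)
  ... | no c≢n = inj₂ (≤∧≢⇒< c≤n c≢n , trans toℕ-ε₁ (sym (begin
    (c * S (toℕ (0 mod m))) % n ≡⟨ cong (λ u → (c * S u) % n) toℕ-ε₂ ⟩
    (c * 0) % n                 ≡⟨ cong (_% n) (*-zeroʳ c) ⟩
    0 % n                       ≡⟨ 0%n≡0 ⟩
    0                           ∎)))
    where open ≡-Reasoning

  petal-∙ : ∀ c x y → petal c x → petal c y → petal c (x ∙ y)
  petal-∙ c x y (inj₁ (c≡n , j≡0)) (inj₁ (_ , l≡0)) =
    inj₁ (c≡n , trans (toℕ-mod _ m) (trans (cong₂ (λ u v → (u + v) % m) j≡0 l≡0) M.0%n≡0))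
  petal-∙ c x y (inj₁ (c≡n , _)) (inj₂ (c<n , _)) = ⊥-elim (<-irrefl c≡n c<n)
  petal-∙ c x y (inj₂ (c<n , _)) (inj₁ (c≡n , _)) = ⊥-elim (<-irrefl c≡n c<n)
  petal-∙ c (i , j) (k , l) (inj₂ (c<n , i≡)) (inj₂ (_ , k≡)) = inj₂ (c<n , trans (toℕ-mod _ n) (begin
    I + K * s ^ J                  ≈⟨ +-cong (≡%⇒≈ i≡) (*-cong (≡%⇒≈ k≡) refl) ⟩
    c * S J + c * S L * s ^ J      ≡⟨ distrib c (S J) (S L) (s ^ J) ⟩
    c * (S J + s ^ J * S L)        ≡⟨ cong (c *_) (repunit-+ s J L) ⟨
    c * S (J + L)                  ≈⟨ *-cong {c} refl (sym (repunit-% (J + L))) ⟩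
    c * S ((J + L) % m)            ≡⟨ cong (λ u → c * S u) (toℕ-mod _ m) ⟨
    c * S (toℕ ((J + L) mod m))    ∎))
    where
    open ≈-Reasoning
    I = toℕ i ; J = toℕ j ; K = toℕ k ; L = toℕ l
    distrib : ∀ c a b p → c * a + c * b * p ≡ c * (a + p * b)
    distrib = solve-∀

  petal-⁻¹ : ∀ c x → petal c x → petal c (x ⁻¹)
  petal-⁻¹ c x (inj₁ (c≡n , j≡0)) =
    inj₁ (c≡n , trans (toℕ-mod _ m) (trans (cong (λ u → (m ∸ u) % m) j≡0) (n%n≡0 m)))
  petal-⁻¹ c (i , j) (inj₂ (c<n , i≡)) = inj₂ (c<n , trans (toℕ-mod _ n)
    (trans (cong (λ w → (n ∸ w) % n) (toℕ-mod X n)) (begin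
      n ∸ X % n                     ≈⟨ +-inverseʳ-unique _ T X (n∸m%n+m≈0 X) T+X≈0 ⟩
      T                             ≈⟨ *-cong {c} refl (sym (repunit-% (m ∸ J))) ⟩
      c * S ((m ∸ J) % m)           ≡⟨ cong (λ u → c * S u) (toℕ-mod _ m) ⟨
      c * S (toℕ ((m ∸ J) mod m))   ∎)))
    where
    open ≈-Reasoning
    J = toℕ j
    X = toℕ i * s ^ (m ∸ J)
    T = c * S (m ∸ J)
    distrib : ∀ c a b p → c * a + c * b * p ≡ c * (a + p * b)
    distrib = solve-∀
    T+X≈0 : T + X ≈ 0
    T+X≈0 = begin
      T + X                                      ≈⟨ +-cong {T} refl (*-cong (≡%⇒≈ i≡) refl) ⟩
      c * S (m ∸ J) + c * S J * s ^ (m ∸ J)      ≡⟨ distrib c (S (m ∸ J)) (S J) (s ^ (m ∸ J)) ⟩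
      c * (S (m ∸ J) + s ^ (m ∸ J) * S J)        ≡⟨ cong (c *_) (repunit-+ s (m ∸ J) J) ⟨
      c * S (m ∸ J + J)                          ≡⟨ cong (λ u → c * S u) (m∸j+j≡m j) ⟩
      c * S m                                    ≈⟨ *-cong {c} refl (trans n∣repunit (sym 0%n≡0)) ⟩
      c * 0                                      ≡⟨ *-zeroʳ c ⟩
      0                                          ∎

  petal-pow : ∀ c → c ≤ n → ∀ x k → petal c x → petal c (pow x k)
  petal-pow c c≤n x zero _ = ε∈petal c c≤n
  petal-pow c c≤n x (suc k) x∈petal = petal-∙ c x _ x∈petal (petal-pow c c≤n x k x∈petal)

  ⟨⟩⊆petal : ∀ c → c ≤ n → ∀ x → petal c x → ⟨ x ⟩ ⊆ petal c
  ⟨⟩⊆petal c c≤n x x∈petal _ (ℤ.+ k , refl) = petal-pow c c≤n x k x∈petal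
  ⟨⟩⊆petal c c≤n x x∈petal _ (-[1+ k ] , refl) = petal-⁻¹ c _ (petal-pow c c≤n x (suc k) x∈petal)

  toℕ-1modm : toℕ (1 mod m) ≡ 1
  toℕ-1modm = trans (toℕ-mod 1 m) (m<n⇒m%n≡m 1<m)

  b : G
  b = 1 mod n , 0 mod m

  pow-b : ∀ k → pow b k ≡ (k mod n , 0 mod m)
  pow-b zero = refl
  pow-b (suc k) = trans (cong (b ∙_) (pow-b k)) (cong₂ _,_ (mod-cong first) (mod-cong second))
    where
    first : toℕ (1 mod n) + toℕ (k mod n) * s ^ toℕ (0 mod m) ≈ suc k
    first = begin
      toℕ (1 mod n) + toℕ (k mod n) * s ^ toℕ (0 mod m)
        ≡⟨ cong₂ (λ u v → u + v * s ^ toℕ (0 mod m)) (toℕ-mod 1 n) (toℕ-mod k n) ⟩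
      1 % n + k % n * s ^ toℕ (0 mod m) ≡⟨ cong (λ v → 1 % n + k % n * s ^ v) toℕ-ε₂ ⟩
      1 % n + k % n * 1                 ≡⟨ cong (1 % n +_) (*-identityʳ (k % n)) ⟩
      1 % n + k % n                     ≈⟨ +-cong (m%n≈m 1) (m%n≈m k) ⟩
      suc k                             ∎
      where open ≈-Reasoning
    second : toℕ (0 mod m) + toℕ (0 mod m) M.≈ 0
    second = cong (λ u → (u + u) % m) toℕ-ε₂

  bᶜa : ℕ → G
  bᶜa c = c mod n , 1 mod m

  pow-bᶜa : ∀ c k → pow (bᶜa c) k ≡ ((c * S k) mod n , k mod m)
  pow-bᶜa c zero = cong₂ _,_ (cong (_mod n) (sym (*-zeroʳ c))) refl
  pow-bᶜa c (suc k) = trans (cong (bᶜa c ∙_) (pow-bᶜa c k)) (cong₂ _,_ (mod-cong first) (mod-cong second))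
    where
    first : toℕ (c mod n) + toℕ ((c * S k) mod n) * s ^ toℕ (1 mod m) ≈ c * S (suc k)
    first = begin
      toℕ (c mod n) + toℕ ((c * S k) mod n) * s ^ toℕ (1 mod m)
        ≡⟨ cong₂ (λ u v → u + v * s ^ toℕ (1 mod m)) (toℕ-mod c n) (toℕ-mod _ n) ⟩
      c % n + (c * S k) % n * s ^ toℕ (1 mod m)
        ≡⟨ cong (λ v → c % n + (c * S k) % n * s ^ v) toℕ-1modm ⟩
      c % n + (c * S k) % n * (s * 1)   ≈⟨ +-cong (m%n≈m c) (*-cong (m%n≈m (c * S k)) refl) ⟩
      c + c * S k * (s * 1)             ≡⟨ distrib c (S k) s ⟩
      c * S (suc k)                     ∎
      where
      open ≈-Reasoning
      distrib : ∀ c x s → c + c * x * (s * 1) ≡ c * (1 + s * x)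
      distrib = solve-∀
    second : toℕ (1 mod m) + toℕ (k mod m) M.≈ suc k
    second = trans (cong₂ (λ u v → (u + v) % m) (toℕ-mod 1 m) (toℕ-mod k m)) (M.+-cong (M.m%n≈m 1) (M.m%n≈m k))

  petal-generator : ∀ c → c ≤ n → ∃[ g ] (petal c ⊆ ⟨ g ⟩ × petal c g × g ≢ ε)
  petal-generator c c≤n with c ≟ n
  ... | yes c≡n = b , petal⊆⟨b⟩ , inj₁ (c≡n , toℕ-ε₂) , b≢ε
    where
    petal⊆⟨b⟩ : petal c ⊆ ⟨ b ⟩
    petal⊆⟨b⟩ (i , j) (inj₁ (_ , j≡0)) =
      ℤ.+ toℕ i , trans (cong₂ _,_ (≡-mod i (toℕ i) refl) (≡-mod j 0 (cong (_% m) j≡0))) (sym (pow-b (toℕ i)))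
    petal⊆⟨b⟩ x (inj₂ (c<n , _)) = ⊥-elim (<-irrefl c≡n c<n)
    b≢ε : b ≢ ε
    b≢ε b≡ε = 1+n≢0 (trans (sym (trans (toℕ-mod 1 n) (m<n⇒m%n≡m 1<n))) (trans (cong (toℕ ∘ proj₁) b≡ε) toℕ-ε₁))
  ... | no c≢n = bᶜa c , petal⊆⟨bᶜa⟩ , inj₂ (c<n , bᶜa∈petal) , bᶜa≢ε
    where
    c<n = ≤∧≢⇒< c≤n c≢n
    petal⊆⟨bᶜa⟩ : petal c ⊆ ⟨ bᶜa c ⟩
    petal⊆⟨bᶜa⟩ x (inj₁ (c≡n , _)) = ⊥-elim (<-irrefl c≡n c<n)
    petal⊆⟨bᶜa⟩ (i , j) (inj₂ (_ , i≡)) =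
      ℤ.+ toℕ j , trans (cong₂ _,_ (≡-mod i _ (≡%⇒≈ i≡)) (≡-mod j (toℕ j) refl)) (sym (pow-bᶜa c (toℕ j)))
    bᶜa∈petal : toℕ (c mod n) ≡ (c * S (toℕ (1 mod m))) % n
    bᶜa∈petal = trans (toℕ-mod c n) (cong (_% n) (begin
      c                      ≡⟨ c≡c*S1 c s ⟩
      c * S 1                ≡⟨ cong (λ v → c * S v) toℕ-1modm ⟨
      c * S (toℕ (1 mod m))  ∎))
      where
      open ≡-Reasoning
      c≡c*S1 : ∀ c s → c ≡ c * (1 + s * 0)
      c≡c*S1 = solve-∀
    bᶜa≢ε : bᶜa c ≢ ε
    bᶜa≢ε bᶜa≡ε = 1+n≢0 (trans (sym toℕ-1modm) (trans (cong (toℕ ∘ proj₂) bᶜa≡ε) toℕ-ε₂))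

  a-exponent-0⇒ε : ∀ c x → toℕ (proj₂ x) ≡ 0 → toℕ (proj₁ x) ≡ (c * S (toℕ (proj₂ x))) % n → x ≡ ε
  a-exponent-0⇒ε c (i , j) j≡0 i≡ = cong₂ _,_
    (toℕ-injective (trans i≡ (trans (cong (λ v → (c * S v) % n) j≡0)
                                    (trans (cong (_% n) (*-zeroʳ c)) (trans 0%n≡0 (sym toℕ-ε₁))))))
    (toℕ-injective (trans j≡0 (sym toℕ-ε₂)))

  repunit-cancel : ∀ {c c′} j → 0 < j → j < m → c * S j ≈ c′ * S j → c ≈ c′
  repunit-cancel {c} {c′} j 0<j j<m cSj≈c′Sj = begin
    c                ≡⟨ *-identityʳ c ⟨
    c * 1            ≈⟨ *-cong {c} refl (sym uSj≈1) ⟩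
    c * (u * S j)    ≡⟨ swap c u (S j) ⟩
    u * (c * S j)    ≈⟨ *-cong {u} refl cSj≈c′Sj ⟩
    u * (c′ * S j)   ≡⟨ swap c′ u (S j) ⟨
    c′ * (u * S j)   ≈⟨ *-cong {c′} refl uSj≈1 ⟩
    c′ * 1           ≡⟨ *-identityʳ c′ ⟩
    c′               ∎
    where
    open ≈-Reasoning
    u = proj₁ (invertible j 0<j j<m)
    uSj≈1 = proj₂ (invertible j 0<j j<m)
    swap : ∀ c u x → c * (u * x) ≡ u * (c * x)
    swap = solve-∀

  petal-∩ : ∀ c c′ → c ≢ c′ → ∀ x → petal c x → petal c′ x → x ≡ ε
  petal-∩ c c′ c≢c′ x (inj₁ (c≡n , _)) (inj₁ (c′≡n , _)) = ⊥-elim (c≢c′ (trans c≡n (sym c′≡n)))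
  petal-∩ c c′ c≢c′ x (inj₁ (_ , j≡0)) (inj₂ (_ , i≡)) = a-exponent-0⇒ε c′ x j≡0 i≡
  petal-∩ c c′ c≢c′ x (inj₂ (_ , i≡)) (inj₁ (_ , j≡0)) = a-exponent-0⇒ε c x j≡0 i≡
  petal-∩ c c′ c≢c′ x@(i , j) (inj₂ (c<n , i≡)) (inj₂ (c′<n , i≡′)) with toℕ j ≟ 0
  ... | yes j≡0 = a-exponent-0⇒ε c x j≡0 i≡
  ... | no j≢0 = ⊥-elim (c≢c′ (trans (sym (m<n⇒m%n≡m c<n)) (trans c≈c′ (m<n⇒m%n≡m c′<n))))
    where
    c≈c′ : c ≈ c′
    c≈c′ = repunit-cancel (toℕ j) (n≢0⇒n>0 j≢0) (toℕ<n j) (trans (sym (≡%⇒≈ i≡)) (≡%⇒≈ i≡′))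

  petals : Fin (suc n) → Subset
  petals k = petal (toℕ k)

  petal-cover : ∀ x → ∃[ k ] petals k x
  petal-cover (i , j) with toℕ j ≟ 0
  ... | yes j≡0 = fromℕ n , inj₁ (toℕ-fromℕ n , j≡0)
  ... | no j≢0 = inject₁ ((u * I) mod n) ,
      subst (λ c → petal c (i , j)) (sym (trans (toℕ-inject₁ _) (toℕ-mod _ n))) (inj₂ (m%n<n (u * I) n , i≡))
    where
    I = toℕ i ; J = toℕ j
    u = proj₁ (invertible J (n≢0⇒n>0 j≢0) (toℕ<n j))
    uSJ≈1 = proj₂ (invertible J (n≢0⇒n>0 j≢0) (toℕ<n j))
    i≡ : I ≡ ((u * I) % n * S J) % n
    i≡ = trans (sym (m<n⇒m%n≡m (toℕ<n i))) (begin
      I                 ≡⟨ *-identityʳ I ⟨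
      I * 1             ≈⟨ *-cong {I} refl (sym uSJ≈1) ⟩
      I * (u * S J)     ≡⟨ *-assoc I u (S J) ⟨
      I * u * S J       ≡⟨ cong (_* S J) (*-comm I u) ⟩
      u * I * S J       ≈⟨ *-cong (sym (m%n≈m (u * I))) refl ⟩
      (u * I) % n * S J ∎)
      where open ≈-Reasoning

  petals-isCyclicPartition : IsCyclicPartition _∙_ ε _⁻¹ (suc n) petals
  petals-isCyclicPartition = record
    { generator = λ k → petal-generator (toℕ k) (toℕ≤n k)
    ; ⟨⟩-⊆ = λ k → ⟨⟩⊆petal (toℕ k) (toℕ≤n k)
    ; cover = petal-cover
    ; trivial-∩ = λ k k′ k≢k′ → petal-∩ (toℕ k) (toℕ k′) (k≢k′ ∘ toℕ-injective)
    }
    where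
    toℕ≤n : ∀ (k : Fin (suc n)) → toℕ k ≤ n
    toℕ≤n k = s≤s⁻¹ (toℕ<n k)

  petal-irrelevant : ∀ c x (p q : petal c x) → p ≡ q
  petal-irrelevant c x (inj₁ (a , b)) (inj₁ (a′ , b′)) = cong₂ (λ u v → inj₁ (u , v)) (≡-irrelevant a a′) (≡-irrelevant b b′)
  petal-irrelevant c x (inj₁ (c≡n , _)) (inj₂ (c<n , _)) = ⊥-elim (<-irrefl c≡n c<n)
  petal-irrelevant c x (inj₂ (c<n , _)) (inj₁ (c≡n , _)) = ⊥-elim (<-irrefl c≡n c<n)
  petal-irrelevant c x (inj₂ (a , b)) (inj₂ (a′ , b′)) = cong₂ (λ u v → inj₂ (u , v)) (<-irrelevant a a′) (≡-irrelevant b b′)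

  petal-≡ : ∀ c {x y : G} → x ≡ y → (p : petal c x) (q : petal c y) → _≡_ {A = Σ G (petal c)} (x , p) (y , q)
  petal-≡ c {x} refl p q = cong (x ,_) (petal-irrelevant c x p q)

  lower-petal-size : ∀ c → c < n → HasSize (petal c) m
  lower-petal-size c c<n = mk↔ₛ′ to (proj₂ ∘ proj₁) to∘from λ _ → refl
    where
    to : Fin m → Σ G (petal c)
    to j = ((c * S (toℕ j)) mod n , j) , inj₂ (c<n , toℕ-mod _ n)
    to∘from : ∀ y → to (proj₂ (proj₁ y)) ≡ y
    to∘from ((i , j) , inj₂ (_ , i≡)) = petal-≡ c (cong (_, j) (sym (≡-mod i _ (≡%⇒≈ i≡)))) _ _
    to∘from ((i , j) , inj₁ (c≡n , _)) = ⊥-elim (<-irrefl c≡n c<n)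

  top-petal-size : HasSize (petal n) n
  top-petal-size = mk↔ₛ′ to (proj₁ ∘ proj₁) to∘from λ _ → refl
    where
    to : Fin n → Σ G (petal n)
    to i = (i , 0 mod m) , inj₁ (refl , toℕ-ε₂)
    to∘from : ∀ y → to (proj₁ (proj₁ y)) ≡ y
    to∘from ((i , j) , inj₁ (_ , j≡0)) = petal-≡ n (cong (i ,_) (sym (≡-mod j 0 (cong (_% m) j≡0)))) _ _
    to∘from ((i , j) , inj₂ (n<n , _)) = ⊥-elim (<-irrefl refl n<n)

lemma4p5 : (m n s : ℕ) .{{_ : NonZero n}} .{{_ : NonZero m}} →
    1 < m → 1 < n → 1 < s →
    n ∣ geom s m →
    (∀ j → 1 ≤ j → j < m → gcd n (geom s j) ≡ 1) →
    let open Semidirect n m s in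
      IsGroup _≡_ _∙_ ε _⁻¹
    × (Fin (m * n) ↔ G)
    × Σ (Fin (ℕ.suc n) → Subset) (λ petals →
          IsFlowerWith (ℕ.suc n) petals (λ x → x ≡ ε)
        × (∀ (i : Fin n) → HasSize (petals (inject₁ i)) m)
        × HasSize (petals (fromℕ n)) n)
lemma4p5 m n s@(suc t) 1<m 1<n 1<s n∣geom coprime =
    isGroup , |G| , petals
  , cyclicPartition⇒flower _∙_ ε _⁻¹ (m * n , |G|) Fin.zero (fromℕ n) 0≢n petals-isCyclicPartition
  , (λ i → subst (λ c → HasSize (petal c) m) (sym (toℕ-inject₁ i)) (lower-petal-size (toℕ i) (toℕ<n i)))
  , subst (λ c → HasSize (petal c) n) (sym (toℕ-fromℕ n)) top-petal-size
  where
  open Semidirect n m s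
  n∣repunit : repunit s m % n ≡ 0
  n∣repunit = n∣m⇒m%n≡0 _ n (subst (n ∣_) (geom≡repunit s 1<s m) n∣geom)
  s^m≈1 : s ^ m % n ≡ 1 % n
  s^m≈1 = repunit≈0⇒^≈1 n t m n∣repunit
  invertible : ∀ j → 0 < j → j < m → ∃[ u ] (u * repunit s j) % n ≡ 1 % n
  invertible j 0<j j<m =
    Congruence.gcd≡1⇒invertible n (repunit s j) (trans (cong (gcd n) (sym (geom≡repunit s 1<s j))) (coprime j 0<j j<m))
  open SemidirectGroup n m s s^m≈1
  open SemidirectPetals n m s 1<n 1<m s^m≈1 n∣repunit invertible
  |G| : Fin (m * n) ↔ G
  |G| = ↔-trans *↔× (×-comm _ _)
  0≢n : Fin.zero ≢ fromℕ n
  0≢n 0≡n = <-irrefl (trans (cong toℕ 0≡n) (toℕ-fromℕ n)) (>-nonZero⁻¹ n)
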